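{- Let $F$ be a Boolean circuit, let $k$ be the cliquewidth of $F$, and let $k^*$ be the smallest width of a type-respecting simplified clique decomposition of (the DAG of) $F$. Then $k^* \leq 6k$.
   Context: Boolean circuits are over $\{\vee,\wedge,\neg\}$ (input gates, NOT gates with one input, AND/OR gates with arbitrary positive fan-in; no constant gates); the DAG of a circuit has gates as vertices and an arc for each wire. Cliquewidth of a circuit: the smallest width of a (directed) clique decomposition of its DAG, where a clique decomposition is a rooted binary tree of vertex-labeled (by natural numbers) directed graphs built by: creating a single vertex with label $i$, disjoint union, $\eta_{i,j}$ (add all arcs from label-$i$ vertices to label-$j$ vertices), $\rho_{i,j}$ (relabel $i$ to $j$); its width is the number of labels used. A labeled directed graph is a triple $(V,E,\mathbf{S})$ with $\mathbf{S}$ a partition of $V$ (the classes are labels). A simplified clique decomposition (SCD) is a rooted tree $T$ in which every node has at most two children and each node $t$ carries a labeled directed graph $G(t)$: a leaf carries $(\{v\},\emptyset,\{\{v\}\})$; a node with two children carries the componentwise union of the (vertex-disjoint) graphs of its children; a node with one child $t_1$ carries a graph obtained from $G(t_1)$ by (i) adding a new vertex $v$ as a singleton label $\{v\}$, or (ii) replacing two labels $S_1,S_2$ by their union, or (iii) for two labels $S_1,S_2$, adding all arcs from vertices of $S_1$ to vertices of $S_2$. The width of an SCD is $\max_t |\mathbf{S}(G(t))|$; it is an SCD of a directed graph $D$ if the unlabeled graph at the root equals $D$. An SCD of a circuit is type-respecting if every non-singleton label occurring in it consists only of input and NOT gates, or only of AND gates, or only of OR gates. -}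

module Defs where

open import Data.Nat using (ℕ; zero; suc; _≤_; _<_; _<ᵇ_; _≡ᵇ_)
open import Data.Fin using (Fin; toℕ)
open import Data.Fin.Properties using () renaming (_≟_ to _≟F_)
open import Data.Bool using (Bool; true; false; _∧_; _∨_; not; if_then_else_)
open import Data.List using (List; []; _∷_; length)
open import Data.Bool.ListAction using (any)
open import Data.Fin.Base using ()
open import Data.List using (allFin)
open import Data.Maybe using (Maybe; just; nothing; _<∣>_)
import Data.Maybe as Maybe
open import Data.Product using (Σ; _×_; _,_)
open import Data.Empty using (⊥)
open import Relation.Nullary using (¬_)
open import Relation.Nullary.Decidable using (⌊_⌋)
open import Relation.Binary.PropositionalEquality using (_≡_; _≢_)
open import Function.Bundles using (_⇔_)

data GateType : Set where
  input notG andG orG : GateType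

countB : ∀ {A : Set} → (A → Bool) → List A → ℕ
countB p []       = 0
countB p (x ∷ xs) = if p x then suc (countB p xs) else countB p xs

_==_ : ∀ {n} → Fin n → Fin n → Bool
u == v = ⌊ u ≟F v ⌋

inDegree : ∀ {n} → (Fin n → Fin n → Bool) → Fin n → ℕ
inDegree {n} E v = countB (λ u → E u v) (allFin n)

data Path {n : ℕ} (E : Fin n → Fin n → Bool) : Fin n → Fin n → Set where
  edge : ∀ {u v} → E u v ≡ true → Path E u v
  step : ∀ {u v w} → E u v ≡ true → Path E v w → Path E u w

-- A Boolean circuit with n gates.  wire u v = true iff there is a wire
-- from gate u into gate v (the DAG of the circuit is (Fin n , wire)).
record Circuit (n : ℕ) : Set where
  field
    gate     : Fin n → GateType
    wire     : Fin n → Fin n → Bool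
    acyclic  : ∀ v → ¬ Path wire v v
    inputDeg : ∀ v → gate v ≡ input → inDegree wire v ≡ 0
    notDeg   : ∀ v → gate v ≡ notG → inDegree wire v ≡ 1
    andDeg   : ∀ v → gate v ≡ andG → 1 ≤ inDegree wire v
    orDeg    : ∀ v → gate v ≡ orG → 1 ≤ inDegree wire v
open Circuit public

-- (Directed) clique decompositions / clique-width expressions.
-- A leaf  single v i  creates the vertex v (a gate) with label i.

data CExpr (n : ℕ) : Set where
  single : Fin n → ℕ → CExpr n
  _⊕_    : CExpr n → CExpr n → CExpr n
  η      : ℕ → ℕ → CExpr n → CExpr n     -- add arcs label i → label j
  ρ      : ℕ → ℕ → CExpr n → CExpr n     -- relabel i to j

-- label of vertex v in the graph of e (nothing = v not a vertex of it)
clab : ∀ {n} → CExpr n → Fin n → Maybe ℕ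
clab (single w i) v = if v == w then just i else nothing
clab (a ⊕ b)      v = clab a v <∣> clab b v
clab (η i j a)    v = clab a v
clab (ρ i j a)    v = Maybe.map (λ l → if l ≡ᵇ i then j else l) (clab a v)

cocc : ∀ {n} → CExpr n → Fin n → Bool
cocc e v = Maybe.is-just (clab e v)

carc : ∀ {n} → CExpr n → Fin n → Fin n → Bool
carc (single w i) u v = false
carc (a ⊕ b)      u v = carc a u v ∨ carc b u v
carc (η i j a)    u v = carc a u v ∨
  (Maybe.maybe (_≡ᵇ i) false (clab a u) ∧ Maybe.maybe (_≡ᵇ j) false (clab a v))
carc (ρ i j a)    u v = carc a u v

data CWF {n : ℕ} : CExpr n → Set where
  single : ∀ v i → CWF (single v i)
  union  : ∀ {a b} → CWF a → CWF b →
           (∀ v → cocc a v ≡ true → cocc b v ≡ false) → CWF (a ⊕ b)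
  eta    : ∀ {i j a} → i ≢ j → CWF a → CWF (η i j a)
  rho    : ∀ {i j a} → CWF a → CWF (ρ i j a)

-- all labels occurring in e are among 0 , … , w-1  (width ≤ w)
data LabelsBelow {n : ℕ} (w : ℕ) : CExpr n → Set where
  single : ∀ {v i} → i < w → LabelsBelow w (single v i)
  union  : ∀ {a b} → LabelsBelow w a → LabelsBelow w b → LabelsBelow w (a ⊕ b)
  eta    : ∀ {i j a} → i < w → j < w → LabelsBelow w a → LabelsBelow w (η i j a)
  rho    : ∀ {i j a} → i < w → j < w → LabelsBelow w a → LabelsBelow w (ρ i j a)

IsCliqueDecomp : ∀ {n} → Circuit n → CExpr n → Set
IsCliqueDecomp F e =
  CWF e × (∀ v → cocc e v ≡ true) × (∀ u v → carc e u v ≡ wire F u v)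

IsCliquewidth : ∀ {n} → Circuit n → ℕ → Set
IsCliquewidth F k =
  (Σ (CExpr _) λ e → IsCliqueDecomp F e × LabelsBelow k e) ×
  (∀ e w → IsCliqueDecomp F e → LabelsBelow w e → k ≤ w)

-- Simplified clique decompositions.  A label (class of the partition)
-- of the graph of a child is referred to by any of its member vertices.

data SCD (n : ℕ) : Set where
  leaf  : Fin n → SCD n                    -- ({v}, ∅, {{v}})
  union : SCD n → SCD n → SCD n            -- componentwise union
  add   : Fin n → SCD n → SCD n            -- (i)  new vertex v, singleton label
  merge : Fin n → Fin n → SCD n → SCD n    -- (ii) replace labels S(x), S(y) by their union
  join  : Fin n → Fin n → SCD n → SCD n    -- (iii) all arcs from S(x) to S(y)

socc : ∀ {n} → SCD n → Fin n → Bool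
socc (leaf w)      v = v == w
socc (union a b)   v = socc a v ∨ socc b v
socc (add w a)     v = (v == w) ∨ socc a v
socc (merge x y a) v = socc a v
socc (join x y a)  v = socc a v

-- same u w = true iff u and w are vertices in the same label
same : ∀ {n} → SCD n → Fin n → Fin n → Bool
same (leaf v)      u w = (u == v) ∧ (w == v)
same (union a b)   u w = same a u w ∨ same b u w
same (add v a)     u w = same a u w ∨ ((u == v) ∧ (w == v))
same (merge x y a) u w = same a u w ∨ (same a u x ∧ same a w y) ∨ (same a u y ∧ same a w x)
same (join x y a)  u w = same a u w

sarc : ∀ {n} → SCD n → Fin n → Fin n → Bool
sarc (leaf v)      u w = false
sarc (union a b)   u w = sarc a u w ∨ sarc b u w
sarc (add v a)     u w = sarc a u w
sarc (merge x y a) u w = sarc a u w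
sarc (join x y a)  u w = sarc a u w ∨ (same a u x ∧ same a w y)

-- number of labels of the graph at the root of t
-- (count the vertices that are the least member of their label)
numLabels : ∀ {n} → SCD n → ℕ
numLabels {n} t = countB
  (λ v → socc t v ∧ not (any (λ u → (toℕ u <ᵇ toℕ v) ∧ same t u v) (allFin n)))
  (allFin n)

data SWF {n : ℕ} : SCD n → Set where
  leaf  : ∀ v → SWF (leaf v)
  union : ∀ {a b} → SWF a → SWF b →
          (∀ v → socc a v ≡ true → socc b v ≡ false) → SWF (union a b)
  add   : ∀ {v a} → SWF a → socc a v ≡ false → SWF (add v a)
  merge : ∀ {x y a} → SWF a → socc a x ≡ true → socc a y ≡ true → SWF (merge x y a)
  join  : ∀ {x y a} → SWF a → socc a x ≡ true → socc a y ≡ true → SWF (join x y a)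

data WidthLE {n : ℕ} (w : ℕ) : SCD n → Set where
  leaf  : ∀ {v} → numLabels (leaf v) ≤ w → WidthLE w (leaf v)
  union : ∀ {a b} → numLabels (union a b) ≤ w → WidthLE w a → WidthLE w b → WidthLE w (union a b)
  add   : ∀ {v a} → numLabels (add v a) ≤ w → WidthLE w a → WidthLE w (add v a)
  merge : ∀ {x y a} → numLabels (merge x y a) ≤ w → WidthLE w a → WidthLE w (merge x y a)
  join  : ∀ {x y a} → numLabels (join x y a) ≤ w → WidthLE w a → WidthLE w (join x y a)

kind : GateType → ℕ
kind input = 0
kind notG  = 0
kind andG  = 1
kind orG   = 2

-- every label of every node consists of gates of a single kind
-- (singleton labels trivially satisfy this)
data TypeResp {n : ℕ} (F : Circuit n) : SCD n → Set where
  leaf  : ∀ {v} → TypeResp F (leaf v)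
  union : ∀ {a b} → (∀ u w → same (union a b) u w ≡ true → kind (gate F u) ≡ kind (gate F w)) →
          TypeResp F a → TypeResp F b → TypeResp F (union a b)
  add   : ∀ {v a} → (∀ u w → same (add v a) u w ≡ true → kind (gate F u) ≡ kind (gate F w)) →
          TypeResp F a → TypeResp F (add v a)
  merge : ∀ {x y a} → (∀ u w → same (merge x y a) u w ≡ true → kind (gate F u) ≡ kind (gate F w)) →
          TypeResp F a → TypeResp F (merge x y a)
  join  : ∀ {x y a} → (∀ u w → same (join x y a) u w ≡ true → kind (gate F u) ≡ kind (gate F w)) →
          TypeResp F a → TypeResp F (join x y a)

IsSCD : ∀ {n} → Circuit n → SCD n → Set
IsSCD F t = SWF t × (∀ v → socc t v ≡ true) × (∀ u v → sarc t u v ≡ wire F u v)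

IsTRSCDWidth : ∀ {n} → Circuit n → ℕ → Set
IsTRSCDWidth F k =
  (Σ (SCD _) λ t → IsSCD F t × TypeResp F t × WidthLE k t) ×
  (∀ t w → IsSCD F t → TypeResp F t → WidthLE w t → k ≤ w)

module Submission where

-- Every clique decomposition of width k of a circuit F can be translated into a
-- type-respecting simplified clique decomposition (SCD) of width at most 6k; as
-- k* is the least such width, k* ≤ 6k.
--
-- The translation runs bottom-up through the clique expression e and produces an
-- SCD t that represents e: t has the vertices and arcs of e, and two vertices
-- share a label of t exactly when they share a label of e and their gates have
-- the same kind (input/NOT, AND, OR), so every label is type-respecting.  Within
-- one expression a vertex is determined, up to its t-label, by its code
-- kind · k + label < 3k.  A leaf of e becomes a leaf; η_{i,j} becomes a join of
-- every pair of t-labels lying in the e-labels i and j; for ⊕ (resp. ρ_{i,j}) we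
-- take the union of the children (resp. the child) and then merge every pair of
-- vertices that now lie in a common class.  Before merging, the codes (shifted
-- by 3k on the right child of ⊕) colour the vertices with fewer than 6k colours
-- such that equal colours only occur inside one label; the merges only coarsen
-- the labels, and a coloured SCD has at most as many labels as colours.

open import Defs
open import Data.Nat using (ℕ; zero; suc; _+_; _*_; _≤_; _<_; z≤n; s≤s; _<ᵇ_; _≡ᵇ_)
open import Data.Nat.Properties
open import Data.Fin using (Fin; toℕ)
open import Data.Fin.Properties using (toℕ-injective) renaming (_≟_ to _≟F_)
open import Data.Bool using (Bool; true; false; _∧_; _∨_; not; if_then_else_)
open import Data.Bool.Properties using (T-≡; T-∧)
open import Data.Bool.ListAction using (any)
open import Data.List using (List; []; _∷_; allFin; cartesianProduct)
open import Data.List.Membership.Propositional using (_∈_; lose)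
open import Data.List.Membership.Propositional.Properties using (∈-allFin; ∈-cartesianProduct⁺)
open import Data.List.Relation.Unary.Any using (here; there)
open import Data.List.Relation.Unary.Any.Properties using (any⁺)
import Data.List.Relation.Unary.All as All
open import Data.List.Relation.Unary.AllPairs using (_∷_)
open import Data.List.Relation.Unary.Unique.Propositional using (Unique)
open import Data.List.Relation.Unary.Unique.Propositional.Properties using (allFin⁺)
open import Data.Maybe using (Maybe; just; nothing; _<∣>_)
import Data.Maybe as Maybe
open import Data.Product using (Σ; _×_; _,_; proj₁; proj₂)
open import Data.Sum using (_⊎_; inj₁; inj₂; [_,_]′)
open import Data.Empty using (⊥)
open import Function.Bundles using (Equivalence)
open import Relation.Nullary using (Dec; yes; no; contradiction)
open import Relation.Nullary.Decidable using (⌊_⌋; toWitness; toWitnessFalse; fromWitness)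
open import Relation.Binary.Structures using (IsPartialEquivalence)
open import Relation.Binary.Definitions using (tri<; tri≈; tri>)
open import Relation.Binary.PropositionalEquality

∨-introˡ : ∀ {a b} → a ≡ true → a ∨ b ≡ true
∨-introˡ refl = refl

∨-introʳ : ∀ {a b} → b ≡ true → a ∨ b ≡ true
∨-introʳ {true}  _ = refl
∨-introʳ {false} h = h

∨-elim : ∀ {a b} → a ∨ b ≡ true → a ≡ true ⊎ b ≡ true
∨-elim {true}  _ = inj₁ refl
∨-elim {false} h = inj₂ h

∧-intro : ∀ {a b} → a ≡ true → b ≡ true → a ∧ b ≡ true
∧-intro refl h = h

∧-projˡ : ∀ {a b} → a ∧ b ≡ true → a ≡ true
∧-projˡ {true} _ = refl

∧-projʳ : ∀ {a b} → a ∧ b ≡ true → b ≡ true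
∧-projʳ {true} h = h

Bool-ext : ∀ {a b} → (a ≡ true → b ≡ true) → (b ≡ true → a ≡ true) → a ≡ b
Bool-ext {true}  {true}  _ _ = refl
Bool-ext {true}  {false} f _ = sym (f refl)
Bool-ext {false} {true}  _ g = g refl
Bool-ext {false} {false} _ _ = refl

==-sound : ∀ {n} {u v : Fin n} → (u == v) ≡ true → u ≡ v
==-sound {u = u} {v} h = toWitness {a? = u ≟F v} (Equivalence.from T-≡ h)

==-refl : ∀ {n} (v : Fin n) → (v == v) ≡ true
==-refl v = Equivalence.to T-≡ (fromWitness {a? = v ≟F v} refl)

exclusive-sym : ∀ {a b} → (a ≡ true → b ≡ false) → b ≡ true → a ≡ false
exclusive-sym {false} _ _ = refl
exclusive-sym {true}  a⇒¬b bTrue = trans (sym bTrue) (a⇒¬b refl)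

is-just-<∣> : ∀ {A : Set} (x y : Maybe A) →
  Maybe.is-just (x <∣> y) ≡ Maybe.is-just x ∨ Maybe.is-just y
is-just-<∣> (just _) y = refl
is-just-<∣> nothing  y = refl

is-just-map : ∀ {A B : Set} (g : A → B) (x : Maybe A) →
  Maybe.is-just (Maybe.map g x) ≡ Maybe.is-just x
is-just-map g (just _) = refl
is-just-map g nothing  = refl

InjectiveOn : {A : Set} → (A → Bool) → (A → ℕ) → Set
InjectiveOn p f = ∀ x y → p x ≡ true → p y ≡ true → f x ≡ f y → x ≡ y

countB-mono : ∀ {A : Set} (p q : A → Bool) xs →
  (∀ x → x ∈ xs → p x ≡ true → q x ≡ true) → countB p xs ≤ countB q xs
countB-mono p q [] _ = z≤n
countB-mono p q (x ∷ xs) p⇒q with p x in px | q x in qx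
... | true  | true  = s≤s (countB-mono p q xs (λ y y∈ → p⇒q y (there y∈)))
... | true  | false = contradiction (trans (sym (p⇒q x (here refl) px)) qx) λ ()
... | false | true  = m≤n⇒m≤1+n (countB-mono p q xs (λ y y∈ → p⇒q y (there y∈)))
... | false | false = countB-mono p q xs (λ y y∈ → p⇒q y (there y∈))

countB-none : ∀ {A : Set} (p : A → Bool) xs → (∀ x → p x ≡ true → ⊥) → countB p xs ≤ 0
countB-none p [] _ = z≤n
countB-none p (x ∷ xs) none with p x in px
... | true  = contradiction px (none x)
... | false = countB-none p xs none

avoiding : {A : Set} → (A → Bool) → (A → ℕ) → ℕ → A → Bool
avoiding p f m x = p x ∧ not ⌊ f x ≟ m ⌋

-- by injectivity at most one counted element has colour m
countB-avoiding : ∀ {A : Set} (p : A → Bool) (f : A → ℕ) m xs → Unique xs →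
  InjectiveOn p f → countB p xs ≤ suc (countB (avoiding p f m) xs)
countB-avoiding p f m [] _ _ = z≤n
countB-avoiding p f m (x ∷ xs) (x∉xs ∷ unique) inj with p x in px | f x ≟ m
... | false | _       = countB-avoiding p f m xs unique inj
... | true  | no _    = s≤s (countB-avoiding p f m xs unique inj)
... | true  | yes fx≡m = s≤s (countB-mono p (avoiding p f m) xs othersAvoid)
  where
  othersAvoid : ∀ y → y ∈ xs → p y ≡ true → avoiding p f m y ≡ true
  othersAvoid y y∈xs py with f y ≟ m
  ... | no _     = ∧-intro py refl
  ... | yes fy≡m = contradiction (inj x y px py (trans fx≡m (sym fy≡m))) (All.lookup x∉xs y∈xs)

-- the counting bound, by induction on W: drop the elements of colour W - 1
countB-≤ : ∀ {A : Set} (f : A → ℕ) W (p : A → Bool) xs → Unique xs →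
  (∀ x → p x ≡ true → f x < W) → InjectiveOn p f → countB p xs ≤ W
countB-≤ f zero p xs _ bounded _ = countB-none p xs (λ x px → contradiction (bounded x px) λ ())
countB-≤ f (suc W) p xs unique bounded inj =
  ≤-trans (countB-avoiding p f W xs unique inj)
          (s≤s (countB-≤ f W (avoiding p f W) xs unique boundedBelowW injAvoiding))
  where
  boundedBelowW : ∀ x → avoiding p f W x ≡ true → f x < W
  boundedBelowW x h = ≤∧≢⇒< (≤-pred (bounded x (∧-projˡ h)))
    (toWitnessFalse (Equivalence.from T-≡ (∧-projʳ {p x} h)))
  injAvoiding : InjectiveOn (avoiding p f W) f
  injAvoiding x y hx hy = inj x y (∧-projˡ hx) (∧-projˡ hy)

-- Colourings.  A W-colouring of an SCD gives its vertices colours below W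
-- so that equally coloured vertices share a label; then there are at most W
-- labels.  This is how all widths are bounded.

record Colouring {n : ℕ} (t : SCD n) (W : ℕ) : Set where
  field
    colour  : Fin n → ℕ
    bounded : ∀ v → socc t v ≡ true → colour v < W
    sameColour⇒sameLabel : ∀ u v → socc t u ≡ true → socc t v ≡ true →
                           colour u ≡ colour v → same t u v ≡ true
open Colouring

-- numLabels counts the least vertex of each label; distinct such vertices
-- lie in distinct labels, hence get distinct colours
numLabels-≤ : ∀ {n} {t : SCD n} {W} → Colouring t W → numLabels t ≤ W
numLabels-≤ {n} {t} {W} col =
  countB-≤ (colour col) W least (allFin n) (allFin⁺ n)
    (λ v h → bounded col v (∧-projˡ h)) colourInjective
  where
  smallerInLabel : Fin n → Fin n → Bool
  smallerInLabel v u = (toℕ u <ᵇ toℕ v) ∧ same t u v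
  least : Fin n → Bool
  least v = socc t v ∧ not (any (smallerInLabel v) (allFin n))
  notLeast : ∀ x y → least y ≡ true → toℕ x < toℕ y → same t x y ≡ true → ⊥
  notLeast x y ly x<y xy with any (smallerInLabel y) (allFin n) in found | ∧-projʳ {socc t y} ly
  ... | false | _ = contradiction
        (trans (sym found) (Equivalence.to T-≡ (any⁺ (smallerInLabel y)
           (lose (∈-allFin x) (Equivalence.from T-∧ (<⇒<ᵇ x<y , Equivalence.from T-≡ xy))))))
        λ ()
  colourInjective : InjectiveOn least (colour col)
  colourInjective x y lx ly eq with <-cmp (toℕ x) (toℕ y)
  ... | tri< x<y _ _ = contradiction
        (sameColour⇒sameLabel col x y (∧-projˡ lx) (∧-projˡ ly) eq) (notLeast x y ly x<y)
  ... | tri≈ _ x≡y _ = toℕ-injective x≡y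
  ... | tri> _ _ y<x = contradiction
        (sameColour⇒sameLabel col y x (∧-projˡ ly) (∧-projˡ lx) (sym eq)) (notLeast y x lx y<x)

colouring-weaken : ∀ {n} {t : SCD n} {W W′} → W ≤ W′ → Colouring t W → Colouring t W′
colouring-weaken W≤W′ col = record
  { colour = colour col
  ; bounded = λ v h → ≤-trans (bounded col v h) W≤W′
  ; sameColour⇒sameLabel = sameColour⇒sameLabel col
  }

union-colouring : ∀ {n} {s t : SCD n} {W₁ W₂} →
  Colouring s W₁ → Colouring t W₂ → Colouring (union s t) (W₁ + W₂)
union-colouring {s = s} {t} {W₁} {W₂} cs ct = record
  { colour = combined ; bounded = combinedBounded ; sameColour⇒sameLabel = combinedSame }
  where
  combined : _ → ℕ
  combined v = if socc s v then colour cs v else W₁ + colour ct v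
  combinedBounded : ∀ v → socc s v ∨ socc t v ≡ true → combined v < W₁ + W₂
  combinedBounded v h with socc s v in sv
  ... | true  = ≤-trans (bounded cs v sv) (m≤m+n W₁ W₂)
  ... | false = +-monoʳ-< W₁ (bounded ct v h)
  leftBelow : ∀ u v → socc s u ≡ true → colour cs u ≡ W₁ + colour ct v → ⊥
  leftBelow u v su eq = <⇒≱ (bounded cs u su) (subst (W₁ ≤_) (sym eq) (m≤m+n W₁ _))
  combinedSame : ∀ u v → socc s u ∨ socc t u ≡ true → socc s v ∨ socc t v ≡ true →
                 combined u ≡ combined v → same s u v ∨ same t u v ≡ true
  combinedSame u v hu hv eq with socc s u in su | socc s v in sv
  ... | true  | true  = ∨-introˡ (sameColour⇒sameLabel cs u v su sv eq)
  ... | false | false = ∨-introʳ (sameColour⇒sameLabel ct u v hu hv (+-cancelˡ-≡ W₁ _ _ eq))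
  ... | true  | false = contradiction eq (leftBelow u v su)
  ... | false | true  = contradiction (sym eq) (leftBelow v u sv)

record Coarsens {n : ℕ} (s t : SCD n) : Set where
  field
    sameVertices : ∀ v → socc s v ≡ socc t v
    labelsGrow   : ∀ u w → same t u w ≡ true → same s u w ≡ true
open Coarsens

coarsens-trans : ∀ {n} {r s t : SCD n} → Coarsens r s → Coarsens s t → Coarsens r t
coarsens-trans rs st = record
  { sameVertices = λ v → trans (sameVertices rs v) (sameVertices st v)
  ; labelsGrow = λ u w h → labelsGrow rs u w (labelsGrow st u w h)
  }

coarsen-colouring : ∀ {n} {s t : SCD n} {W} → Coarsens s t → Colouring t W → Colouring s W
coarsen-colouring st col = record
  { colour = colour col
  ; bounded = λ v h → bounded col v (trans (sym (sameVertices st v)) h)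
  ; sameColour⇒sameLabel = λ u v hu hv eq → labelsGrow st u v
      (sameColour⇒sameLabel col u v (trans (sym (sameVertices st u)) hu)
                                    (trans (sym (sameVertices st v)) hv) eq)
  }

widthLE-root : ∀ {n W} {t : SCD n} → WidthLE W t → numLabels t ≤ W
widthLE-root (leaf h)      = h
widthLE-root (union h _ _) = h
widthLE-root (add h _)     = h
widthLE-root (merge h _)   = h
widthLE-root (join h _)    = h

SameKind : ∀ {n} → Circuit n → Fin n → Fin n → Set
SameKind F u w = kind (gate F u) ≡ kind (gate F w)

sameKind-isPE : ∀ {n} (F : Circuit n) → IsPartialEquivalence (SameKind F)
sameKind-isPE F = record { sym = sym ; trans = trans }

typeResp-root : ∀ {n} {F : Circuit n} {t : SCD n} → TypeResp F t →
  ∀ u w → same t u w ≡ true → SameKind F u w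
typeResp-root {t = leaf v} leaf u w h
  rewrite ==-sound {u = u} (∧-projˡ h) | ==-sound {u = w} (∧-projʳ {u == v} h) = refl
typeResp-root (union h _ _) = h
typeResp-root (add h _)     = h
typeResp-root (merge h _)   = h
typeResp-root (join h _)    = h

merge-coarsens : ∀ {n} x y (s : SCD n) → Coarsens (merge x y s) s
merge-coarsens x y s = record { sameVertices = λ v → refl ; labelsGrow = λ u w → ∨-introˡ }

merge-sound : ∀ {n} (P : Fin n → Fin n → Set) → IsPartialEquivalence P →
  ∀ x y (s : SCD n) → (∀ u w → same s u w ≡ true → P u w) → P x y →
  ∀ u w → same (merge x y s) u w ≡ true → P u w
merge-sound P record { sym = P-sym ; trans = P-trans } x y s sameP Pxy u w h with ∨-elim h
... | inj₁ old = sameP u w old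
... | inj₂ new with ∨-elim new
...   | inj₁ ux-wy = P-trans (P-trans (sameP u x (∧-projˡ ux-wy)) Pxy)
                             (P-sym (sameP w y (∧-projʳ {same s u x} ux-wy)))
...   | inj₂ uy-wx = P-trans (sameP u y (∧-projˡ uy-wx))
                             (P-trans (P-sym Pxy) (P-sym (sameP w x (∧-projʳ {same s u y} uy-wx))))

module Iterated {n : ℕ} (c : Fin n → Fin n → Bool) (t : SCD n) where

  mergeAll : List (Fin n × Fin n) → SCD n
  mergeAll [] = t
  mergeAll ((x , y) ∷ ps) = if c x y then merge x y (mergeAll ps) else mergeAll ps

  joinAll : List (Fin n × Fin n) → SCD n
  joinAll [] = t
  joinAll ((x , y) ∷ ps) = if c x y then join x y (joinAll ps) else joinAll ps

  SelectsVertices : Set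
  SelectsVertices = ∀ x y → c x y ≡ true → socc t x ≡ true × socc t y ≡ true

  mergeAll-coarsens : ∀ ps → Coarsens (mergeAll ps) t
  mergeAll-coarsens [] = record { sameVertices = λ v → refl ; labelsGrow = λ u w h → h }
  mergeAll-coarsens ((x , y) ∷ ps) with c x y
  ... | true  = coarsens-trans (merge-coarsens x y (mergeAll ps)) (mergeAll-coarsens ps)
  ... | false = mergeAll-coarsens ps

  mergeAll-arcs : ∀ ps u w → sarc (mergeAll ps) u w ≡ sarc t u w
  mergeAll-arcs [] u w = refl
  mergeAll-arcs ((x , y) ∷ ps) u w with c x y
  ... | true  = mergeAll-arcs ps u w
  ... | false = mergeAll-arcs ps u w

  mergeAll-sound : (P : Fin n → Fin n → Set) → IsPartialEquivalence P →
    (∀ u w → same t u w ≡ true → P u w) → (∀ x y → c x y ≡ true → P x y) →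
    ∀ ps u w → same (mergeAll ps) u w ≡ true → P u w
  mergeAll-sound P isPE sameP cP [] = sameP
  mergeAll-sound P isPE sameP cP ((x , y) ∷ ps) with c x y in cxy
  ... | true  = merge-sound P isPE x y (mergeAll ps) (mergeAll-sound P isPE sameP cP ps) (cP x y cxy)
  ... | false = mergeAll-sound P isPE sameP cP ps

  mergeAll-complete : (∀ v → socc t v ≡ true → same t v v ≡ true) →
    ∀ ps x y → (x , y) ∈ ps → c x y ≡ true → socc t x ≡ true → socc t y ≡ true →
    same (mergeAll ps) x y ≡ true
  mergeAll-complete selfSame ((x , y) ∷ ps) x y (here refl) cxy tx ty rewrite cxy =
    ∨-introʳ {same (mergeAll ps) x y}
      (∨-introˡ (∧-intro (grow x (selfSame x tx)) (grow y (selfSame y ty))))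
    where grow : ∀ v → same t v v ≡ true → same (mergeAll ps) v v ≡ true
          grow v = labelsGrow (mergeAll-coarsens ps) v v
  mergeAll-complete selfSame ((x′ , y′) ∷ ps) x y (there xy∈ps) cxy tx ty with c x′ y′
  ... | true  = ∨-introˡ (mergeAll-complete selfSame ps x y xy∈ps cxy tx ty)
  ... | false = mergeAll-complete selfSame ps x y xy∈ps cxy tx ty

  mergeAll-wellFormed : SWF t → SelectsVertices → ∀ ps → SWF (mergeAll ps)
  mergeAll-wellFormed wf sel [] = wf
  mergeAll-wellFormed wf sel ((x , y) ∷ ps) with c x y in cxy
  ... | true  = merge (mergeAll-wellFormed wf sel ps)
                      (trans (sameVertices (mergeAll-coarsens ps) x) (proj₁ (sel x y cxy)))
                      (trans (sameVertices (mergeAll-coarsens ps) y) (proj₂ (sel x y cxy)))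
  ... | false = mergeAll-wellFormed wf sel ps

  mergeAll-typeResp : {F : Circuit n} → TypeResp F t →
    (∀ x y → c x y ≡ true → SameKind F x y) → ∀ ps → TypeResp F (mergeAll ps)
  mergeAll-typeResp tr cKind [] = tr
  mergeAll-typeResp {F} tr cKind ((x , y) ∷ ps) with c x y in cxy
  ... | true  = merge (merge-sound (SameKind F) (sameKind-isPE F) x y (mergeAll ps)
                        (mergeAll-sound (SameKind F) (sameKind-isPE F) (typeResp-root tr) cKind ps)
                        (cKind x y cxy))
                      (mergeAll-typeResp tr cKind ps)
  ... | false = mergeAll-typeResp tr cKind ps

  -- every intermediate node coarsens t, so a colouring of t bounds its width
  mergeAll-width : ∀ {W} → Colouring t W → WidthLE W t → ∀ ps → WidthLE W (mergeAll ps)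
  mergeAll-width col wid [] = wid
  mergeAll-width col wid ((x , y) ∷ ps) with c x y
  ... | true  = merge (numLabels-≤ (coarsen-colouring
                  (coarsens-trans (merge-coarsens x y (mergeAll ps)) (mergeAll-coarsens ps)) col))
                (mergeAll-width col wid ps)
  ... | false = mergeAll-width col wid ps

  joinAll-vertices : ∀ ps v → socc (joinAll ps) v ≡ socc t v
  joinAll-vertices [] v = refl
  joinAll-vertices ((x , y) ∷ ps) v with c x y
  ... | true  = joinAll-vertices ps v
  ... | false = joinAll-vertices ps v

  joinAll-labels : ∀ ps u w → same (joinAll ps) u w ≡ same t u w
  joinAll-labels [] u w = refl
  joinAll-labels ((x , y) ∷ ps) u w with c x y
  ... | true  = joinAll-labels ps u w
  ... | false = joinAll-labels ps u w

  joinAll-keepsArcs : ∀ ps {u w} → sarc t u w ≡ true → sarc (joinAll ps) u w ≡ true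
  joinAll-keepsArcs [] h = h
  joinAll-keepsArcs ((x , y) ∷ ps) h with c x y
  ... | true  = ∨-introˡ (joinAll-keepsArcs ps h)
  ... | false = joinAll-keepsArcs ps h

  joinAll-newArcs : ∀ ps u w → sarc (joinAll ps) u w ≡ true →
    sarc t u w ≡ true ⊎
    Σ (Fin n) λ x → Σ (Fin n) λ y → c x y ≡ true × same t u x ≡ true × same t w y ≡ true
  joinAll-newArcs [] u w h = inj₁ h
  joinAll-newArcs ((x , y) ∷ ps) u w h with c x y in cxy
  ... | false = joinAll-newArcs ps u w h
  ... | true with ∨-elim h
  ...   | inj₁ old = joinAll-newArcs ps u w old
  ...   | inj₂ new = inj₂ (x , y , cxy ,
            trans (sym (joinAll-labels ps u x)) (∧-projˡ new) ,
            trans (sym (joinAll-labels ps w y)) (∧-projʳ {same (joinAll ps) u x} new))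

  joinAll-complete : ∀ ps x y → (x , y) ∈ ps → c x y ≡ true →
    same t x x ≡ true → same t y y ≡ true → sarc (joinAll ps) x y ≡ true
  joinAll-complete ((x , y) ∷ ps) x y (here refl) cxy xx yy rewrite cxy =
    ∨-introʳ {sarc (joinAll ps) x y}
      (∧-intro (trans (joinAll-labels ps x x) xx) (trans (joinAll-labels ps y y) yy))
  joinAll-complete ((x′ , y′) ∷ ps) x y (there xy∈ps) cxy xx yy with c x′ y′
  ... | true  = ∨-introˡ (joinAll-complete ps x y xy∈ps cxy xx yy)
  ... | false = joinAll-complete ps x y xy∈ps cxy xx yy

  joinAll-wellFormed : SWF t → SelectsVertices → ∀ ps → SWF (joinAll ps)
  joinAll-wellFormed wf sel [] = wf
  joinAll-wellFormed wf sel ((x , y) ∷ ps) with c x y in cxy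
  ... | true  = join (joinAll-wellFormed wf sel ps)
                     (trans (joinAll-vertices ps x) (proj₁ (sel x y cxy)))
                     (trans (joinAll-vertices ps y) (proj₂ (sel x y cxy)))
  ... | false = joinAll-wellFormed wf sel ps

  joinAll-typeResp : {F : Circuit n} → TypeResp F t → ∀ ps → TypeResp F (joinAll ps)
  joinAll-typeResp tr [] = tr
  joinAll-typeResp tr ((x , y) ∷ ps) with c x y
  ... | true  = join (λ u w h → typeResp-root tr u w (trans (sym (joinAll-labels ps u w)) h))
                     (joinAll-typeResp tr ps)
  ... | false = joinAll-typeResp tr ps

  -- joins do not change the labels, hence not the width
  joinAll-width : ∀ {W} → WidthLE W t → ∀ ps → WidthLE W (joinAll ps)
  joinAll-width wid [] = wid
  joinAll-width wid ((x , y) ∷ ps) with c x y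
  ... | true  = join (widthLE-root (joinAll-width wid ps)) (joinAll-width wid ps)
  ... | false = joinAll-width wid ps

open Iterated

allPairs : ∀ n → List (Fin n × Fin n)
allPairs n = cartesianProduct (allFin n) (allFin n)

∈-allPairs : ∀ {n} (x y : Fin n) → (x , y) ∈ allPairs n
∈-allPairs x y = ∈-cartesianProduct⁺ (∈-allFin x) (∈-allFin y)

kind<3 : ∀ g → kind g < 3
kind<3 input = s≤s z≤n
kind<3 notG  = s≤s z≤n
kind<3 andG  = s≤s (s≤s z≤n)
kind<3 orG   = s≤s (s≤s (s≤s z≤n))

digits-unique : ∀ a c {b d m} → b < m → d < m → a * m + b ≡ c * m + d → a ≡ c × b ≡ d
digits-unique zero zero _ _ eq = refl , eq
digits-unique zero (suc c) {b} {d} {m} b<m _ eq =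
  contradiction (subst (m ≤_) (sym eq) (≤-trans (m≤m+n m (c * m)) (m≤m+n _ d))) (<⇒≱ b<m)
digits-unique (suc a) zero {b} {d} {m} _ d<m eq =
  contradiction (subst (m ≤_) eq (≤-trans (m≤m+n m (a * m)) (m≤m+n _ b))) (<⇒≱ d<m)
digits-unique (suc a) (suc c) {b} {d} {m} b<m d<m eq
  with digits-unique a c b<m d<m
         (+-cancelˡ-≡ m _ _ (trans (sym (+-assoc m (a * m) b)) (trans eq (+-assoc m (c * m) d))))
... | refl , b≡d = refl , b≡d

module Translation {n : ℕ} (F : Circuit n) (k : ℕ) where

  kd : Fin n → ℕ
  kd v = kind (gate F v)

  -- u and w carry the same label in e and have gates of the same kind:
  -- this is exactly the label structure the translated SCD will have
  SameClass : CExpr n → Fin n → Fin n → Set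
  SameClass e u w = Σ ℕ λ l → clab e u ≡ just l × clab e w ≡ just l × SameKind F u w

  sameClass-isPE : ∀ e → IsPartialEquivalence (SameClass e)
  sameClass-isPE e = record
    { sym = λ (l , eu , ew , kk) → l , ew , eu , sym kk
    ; trans = λ { (l , eu , ev , kk) (l′ , ev′ , ew , kk′) → l , eu ,
                  trans ew (trans (sym ev′) ev) , trans kk kk′ }
    }

  -- SameClass is decidable, so the merges can select its pairs
  sameClass? : ∀ e u w → Dec (SameClass e u w)
  sameClass? e u w with clab e u | clab e w | kd u ≟ kd w
  ... | nothing | _       | _      = no λ { (_ , () , _) }
  ... | just l  | nothing | _      = no λ { (_ , _ , () , _) }
  ... | just l  | just l′ | no k≢  = no λ (_ , _ , _ , kk) → k≢ kk
  ... | just l  | just l′ | yes kk with l ≟ l′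
  ...   | yes refl = yes (l , refl , refl , kk)
  ...   | no l≢l′  = no λ { (_ , refl , refl , _) → l≢l′ refl }

  sameClassᵇ : CExpr n → Fin n → Fin n → Bool
  sameClassᵇ e u w = ⌊ sameClass? e u w ⌋

  sameClassᵇ-sound : ∀ e u w → sameClassᵇ e u w ≡ true → SameClass e u w
  sameClassᵇ-sound e u w h = toWitness {a? = sameClass? e u w} (Equivalence.from T-≡ h)

  sameClassᵇ-complete : ∀ e u w → SameClass e u w → sameClassᵇ e u w ≡ true
  sameClassᵇ-complete e u w sc = Equivalence.to T-≡ (fromWitness {a? = sameClass? e u w} sc)

  labelled⇒occurs : ∀ (e : CExpr n) (v : Fin n) {l} → clab e v ≡ just l → cocc e v ≡ true
  labelled⇒occurs e v h rewrite h = refl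

  occurs⇒labelled : ∀ (e : CExpr n) (v : Fin n) → cocc e v ≡ true → Σ ℕ λ l → clab e v ≡ just l
  occurs⇒labelled e v h with clab e v | h
  ... | just l | _ = l , refl

  unlabelled : ∀ (e : CExpr n) (v : Fin n) → cocc e v ≡ false → clab e v ≡ nothing
  unlabelled e v h with clab e v | h
  ... | nothing | _ = refl

  label<k : ∀ {e : CExpr n} (v : Fin n) {l} → LabelsBelow k e → clab e v ≡ just l → l < k
  label<k {single w i} v (single i<k) h with v == w | h
  ... | true | refl = i<k
  label<k {a ⊕ b} v (union below-a below-b) h with clab a v in av | h
  ... | just _  | refl = label<k v below-a av
  ... | nothing | h′   = label<k v below-b h′
  label<k v (eta _ _ below) h = label<k v below h
  label<k {ρ i j a} v (rho _ j<k below) h with clab a v in av | h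
  ... | just l′ | refl with l′ ≡ᵇ i
  ...   | true  = j<k
  ...   | false = label<k v below av

  code : CExpr n → Fin n → ℕ
  code e v = Maybe.maybe (λ l → kd v * k + l) 0 (clab e v)

  code<3k : ∀ {e} v → LabelsBelow k e → cocc e v ≡ true → code e v < 3 * k
  code<3k {e} v below h with clab e v in ev | h
  ... | just l | _ = begin-strict
      kd v * k + l   <⟨ +-monoʳ-< (kd v * k) (label<k v below ev) ⟩
      kd v * k + k   ≡⟨ +-comm (kd v * k) k ⟩
      suc (kd v) * k ≤⟨ *-monoˡ-≤ k (kind<3 (gate F v)) ⟩
      3 * k          ∎
    where open ≤-Reasoning

  code-injective : ∀ {e} u v → LabelsBelow k e → cocc e u ≡ true → cocc e v ≡ true →
    code e u ≡ code e v → SameClass e u v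
  code-injective {e} u v below hu hv eq with clab e u in eu | clab e v in ev | hu | hv | eq
  ... | just l | just l′ | _ | _ | eq′
    with digits-unique (kd u) (kd v) (label<k u below eu) (label<k v below ev) eq′
  ...   | kk , refl = l , refl , refl , kk

  record Refines (e : CExpr n) (t : SCD n) : Set where
    field
      vertices   : ∀ v → socc t v ≡ cocc e v
      arcs       : ∀ u w → sarc t u w ≡ carc e u w
      labelSound : ∀ u w → same t u w ≡ true → SameClass e u w
      wellFormed : SWF t
      typeResp   : TypeResp F t
      width      : WidthLE (6 * k) t
  open Refines public

  record Represents (e : CExpr n) (t : SCD n) : Set where
    field
      refines       : Refines e t
      labelComplete : ∀ u w → SameClass e u w → same t u w ≡ true
  open Represents public

  occursIn : ∀ {e t} → Refines e t → ∀ v → socc t v ≡ true → cocc e v ≡ true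
  occursIn R v h = trans (sym (vertices R v)) h

  codeColouring : ∀ {e t} → Represents e t → LabelsBelow k e → Colouring t (3 * k)
  codeColouring {e} R below = record
    { colour = code e
    ; bounded = λ v h → code<3k v below (occursIn (refines R) v h)
    ; sameColour⇒sameLabel = λ u v hu hv eq → labelComplete R u v
        (code-injective u v below (occursIn (refines R) u hu) (occursIn (refines R) v hv) eq)
    }

  3k≤6k : 3 * k ≤ 6 * k
  3k≤6k = *-monoˡ-≤ k (s≤s (s≤s (s≤s (z≤n {3}))))

  closeLabels : CExpr n → SCD n → SCD n
  closeLabels e t = mergeAll (sameClassᵇ e) t (allPairs n)

  closeLabels-represents : ∀ {e t} → Refines e t → Colouring t (6 * k) →
    Represents e (closeLabels e t)
  closeLabels-represents {e} {t} R col = record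
    { refines = record
      { vertices   = λ v → trans (sameVertices (mergeAll-coarsens c t pairs) v) (vertices R v)
      ; arcs       = λ u w → trans (mergeAll-arcs c t pairs u w) (arcs R u w)
      ; labelSound = mergeAll-sound c t (SameClass e) (sameClass-isPE e) (labelSound R)
                       (sameClassᵇ-sound e) pairs
      ; wellFormed = mergeAll-wellFormed c t (wellFormed R) selectsVertices pairs
      ; typeResp   = mergeAll-typeResp c t (typeResp R)
                       (λ x y cxy → proj₂ (proj₂ (proj₂ (sameClassᵇ-sound e x y cxy)))) pairs
      ; width      = mergeAll-width c t col (width R) pairs
      }
    ; labelComplete = λ u w sc → mergeAll-complete c t selfSame pairs u w (∈-allPairs u w)
        (sameClassᵇ-complete e u w sc) (occursLeft u w sc) (occursLeft w u (class-sym sc))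
    }
    where
    open IsPartialEquivalence (sameClass-isPE e) using () renaming (sym to class-sym)
    c = sameClassᵇ e
    pairs = allPairs n
    occursLeft : ∀ u w → SameClass e u w → socc t u ≡ true
    occursLeft u w (_ , eu , _) = trans (vertices R u) (labelled⇒occurs e u eu)
    selectsVertices : SelectsVertices c t
    selectsVertices x y cxy = occursLeft x y sc , occursLeft y x (class-sym sc)
      where sc = sameClassᵇ-sound e x y cxy
    -- the colouring forces every vertex into its own label
    selfSame : ∀ v → socc t v ≡ true → same t v v ≡ true
    selfSame v h = sameColour⇒sameLabel col v v h h refl

  -- a leaf represents a single vertex; as k > 0 one colour fits below 6k
  represents-leaf : ∀ v i → i < k → Represents (single v i) (leaf v)
  represents-leaf v i i<k = record
    { refines = record
      { vertices   = leafVertex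
      ; arcs       = λ u w → refl
      ; labelSound = leafLabel
      ; wellFormed = leaf v
      ; typeResp   = leaf
      ; width      = leaf (numLabels-≤ oneColour)
      }
    ; labelComplete = λ u w (_ , eu , ew , _) → ∧-intro (isLeaf u eu) (isLeaf w ew)
    }
    where
    labelV : clab (single v i) v ≡ just i
    labelV = cong (λ b → if b then just i else nothing) (==-refl v)
    leafVertex : ∀ u → socc (leaf v) u ≡ cocc (single v i) u
    leafVertex u with u == v
    ... | true  = refl
    ... | false = refl
    leafLabel : ∀ u w → same (leaf v) u w ≡ true → SameClass (single v i) u w
    leafLabel u w h
      rewrite ==-sound {u = u} (∧-projˡ h) | ==-sound {u = w} (∧-projʳ {u == v} h) =
      i , labelV , labelV , refl
    isLeaf : ∀ u {l} → clab (single v i) u ≡ just l → (u == v) ≡ true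
    isLeaf u h with u == v | h
    ... | true | _ = refl
    oneColour : Colouring (leaf v) (6 * k)
    oneColour = record
      { colour = λ _ → 0
      ; bounded = λ _ _ → ≤-trans (≤-trans (s≤s z≤n) i<k) (m≤n*m k 6)
      ; sameColour⇒sameLabel = λ u w hu hw _ → ∧-intro hu hw
      }

  represents-selfSame : ∀ {e t} → Represents e t → ∀ v → cocc e v ≡ true → same t v v ≡ true
  represents-selfSame {e} R v h with occurs⇒labelled e v h
  ... | l , ev = labelComplete R v v (l , ev , ev , refl)

  sameClass-⊕ˡ : ∀ a b {u w} → SameClass a u w → SameClass (a ⊕ b) u w
  sameClass-⊕ˡ a b {u} {w} (l , eu , ew , kk) =
    l , cong (_<∣> clab b u) eu , cong (_<∣> clab b w) ew , kk

  sameClass-⊕ʳ : ∀ a b {u w} → cocc a u ≡ false → cocc a w ≡ false →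
    SameClass b u w → SameClass (a ⊕ b) u w
  sameClass-⊕ʳ a b {u} {w} au aw (l , eu , ew , kk) =
    l , trans (cong (_<∣> clab b u) (unlabelled a u au)) eu ,
        trans (cong (_<∣> clab b w) (unlabelled a w aw)) ew , kk

  -- codes of the left summand, and codes shifted by 3k on the right summand
  union-coloured : ∀ {a b ta tb} → Represents a ta → Represents b tb →
    LabelsBelow k a → LabelsBelow k b → Colouring (union ta tb) (6 * k)
  union-coloured RA RB below-a below-b =
    colouring-weaken (≤-reflexive (sym (*-distribʳ-+ k 3 3)))
      (union-colouring (codeColouring RA below-a) (codeColouring RB below-b))

  refines-union : ∀ {a b ta tb} → (∀ v → cocc a v ≡ true → cocc b v ≡ false) →
    Represents a ta → Represents b tb → Colouring (union ta tb) (6 * k) →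
    Refines (a ⊕ b) (union ta tb)
  refines-union {a} {b} {ta} {tb} disjoint RA RB col = record
    { vertices   = λ v → trans (cong₂ _∨_ (vertices A v) (vertices B v))
                                (sym (is-just-<∣> (clab a v) (clab b v)))
    ; arcs       = λ u w → cong₂ _∨_ (arcs A u w) (arcs B u w)
    ; labelSound = unionLabel
    ; wellFormed = union (wellFormed A) (wellFormed B)
                     (λ v h → trans (vertices B v) (disjoint v (occursIn A v h)))
    ; typeResp   = union (λ u w h → [ typeResp-root (typeResp A) u w
                                      , typeResp-root (typeResp B) u w ]′ (∨-elim h))
                         (typeResp A) (typeResp B)
    ; width      = union (numLabels-≤ col) (width A) (width B)
    }
    where
    A = refines RA
    B = refines RB
    notLeft : ∀ v {l} → clab b v ≡ just l → cocc a v ≡ false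
    notLeft v bv = exclusive-sym (disjoint v) (labelled⇒occurs b v bv)
    unionLabel : ∀ u w → same (union ta tb) u w ≡ true → SameClass (a ⊕ b) u w
    unionLabel u w h with ∨-elim h
    ... | inj₁ left  = sameClass-⊕ˡ a b (labelSound A u w left)
    ... | inj₂ right with labelSound B u w right
    ...   | sc@(_ , bu , bw , _) = sameClass-⊕ʳ a b (notLeft u bu) (notLeft w bw) sc

  relabel : ℕ → ℕ → ℕ → ℕ
  relabel i j l = if l ≡ᵇ i then j else l

  -- relabelling only fuses classes, so the child's SCD refines ρ_{i,j} a
  refines-rho : ∀ {i j a ta} → Represents a ta → Refines (ρ i j a) ta
  refines-rho {i} {j} {a} RA = record
    { vertices   = λ v → trans (vertices A v) (sym (is-just-map (relabel i j) (clab a v)))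
    ; arcs       = arcs A
    ; labelSound = λ u w h → relabelClass (labelSound A u w h)
    ; wellFormed = wellFormed A
    ; typeResp   = typeResp A
    ; width      = width A
    }
    where
    A = refines RA
    relabelClass : ∀ {u w} → SameClass a u w → SameClass (ρ i j a) u w
    relabelClass (l , eu , ew , kk) =
      relabel i j l , cong (Maybe.map (relabel i j)) eu , cong (Maybe.map (relabel i j)) ew , kk

  hasLabel : CExpr n → ℕ → Fin n → Bool
  hasLabel a i v = Maybe.maybe (_≡ᵇ i) false (clab a v)

  hasLabel⇒occurs : ∀ a i v → hasLabel a i v ≡ true → cocc a v ≡ true
  hasLabel⇒occurs a i v h with clab a v | h
  ... | just _ | _ = refl

  hasLabel-class : ∀ {a} i {u x : Fin n} → SameClass a u x → hasLabel a i u ≡ hasLabel a i x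
  hasLabel-class i (l , eu , ex , _) = cong (Maybe.maybe (_≡ᵇ i) false) (trans eu (sym ex))

  crossing : CExpr n → ℕ → ℕ → Fin n → Fin n → Bool
  crossing a i j x y = hasLabel a i x ∧ hasLabel a j y

  addArcs : CExpr n → ℕ → ℕ → SCD n → SCD n
  addArcs a i j t = joinAll (crossing a i j) t (allPairs n)

  represents-eta : ∀ {i j a ta} → Represents a ta → Represents (η i j a) (addArcs a i j ta)
  represents-eta {i} {j} {a} {ta} RA = record
    { refines = record
      { vertices   = λ v → trans (joinAll-vertices c ta pairs v) (vertices A v)
      ; arcs       = λ u w → Bool-ext (arcSound u w) (arcComplete u w)
      ; labelSound = λ u w h → labelSound A u w (trans (sym (joinAll-labels c ta pairs u w)) h)
      ; wellFormed = joinAll-wellFormed c ta (wellFormed A) selectsVertices pairs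
      ; typeResp   = joinAll-typeResp c ta (typeResp A) pairs
      ; width      = joinAll-width c ta (width A) pairs
      }
    ; labelComplete = λ u w sc → trans (joinAll-labels c ta pairs u w) (labelComplete RA u w sc)
    }
    where
    A = refines RA
    c = crossing a i j
    pairs = allPairs n
    selectsVertices : SelectsVertices c ta
    selectsVertices x y cxy =
      trans (vertices A x) (hasLabel⇒occurs a i x (∧-projˡ cxy)) ,
      trans (vertices A y) (hasLabel⇒occurs a j y (∧-projʳ {hasLabel a i x} cxy))
    arcSound : ∀ u w → sarc (addArcs a i j ta) u w ≡ true → carc (η i j a) u w ≡ true
    arcSound u w h with joinAll-newArcs c ta pairs u w h
    ... | inj₁ old = ∨-introˡ (trans (sym (arcs A u w)) old)
    ... | inj₂ (x , y , cxy , ux , wy) = ∨-introʳ {carc a u w}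
          (trans (cong₂ _∧_ (hasLabel-class {a} i (labelSound A u x ux))
                            (hasLabel-class {a} j (labelSound A w y wy))) cxy)
    arcComplete : ∀ u w → carc (η i j a) u w ≡ true → sarc (addArcs a i j ta) u w ≡ true
    arcComplete u w h with ∨-elim h
    ... | inj₁ old = joinAll-keepsArcs c ta pairs (trans (arcs A u w) old)
    ... | inj₂ new = joinAll-complete c ta pairs u w (∈-allPairs u w) new
          (represents-selfSame RA u (hasLabel⇒occurs a i u (∧-projˡ new)))
          (represents-selfSame RA w (hasLabel⇒occurs a j w (∧-projʳ {hasLabel a i u} new)))

  build : ∀ {e} → CWF e → LabelsBelow k e → Σ (SCD n) (Represents e)
  build (single v i) (single i<k) = leaf v , represents-leaf v i i<k
  build {a ⊕ b} (union wf-a wf-b disjoint) (union below-a below-b)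
    with build wf-a below-a | build wf-b below-b
  ... | ta , RA | tb , RB = closeLabels (a ⊕ b) (union ta tb) ,
        closeLabels-represents (refines-union disjoint RA RB col) col
    where col = union-coloured RA RB below-a below-b
  build {η i j a} (eta _ wf) (eta _ _ below) with build wf below
  ... | ta , RA = addArcs a i j ta , represents-eta RA
  build {ρ i j a} (rho wf) (rho _ _ below) with build wf below
  ... | ta , RA = closeLabels (ρ i j a) ta ,
        closeLabels-represents (refines-rho RA) (colouring-weaken 3k≤6k (codeColouring RA below))

lemma1 : ∀ {n} (F : Circuit n) (k k* : ℕ) →
    IsCliquewidth F k → IsTRSCDWidth F k* → k* ≤ 6 * k
lemma1 F k k* ((e , (wf , covers , arcsAreWires) , below) , _) (_ , minimal) =
  minimal t (6 * k) isSCD (typeResp R) (width R)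
  where
  open Translation F k
  t : SCD _
  t = proj₁ (build wf below)
  R : Refines e t
  R = refines (proj₂ (build wf below))
  isSCD : IsSCD F t
  isSCD = wellFormed R , (λ v → trans (vertices R v) (covers v)) ,
          (λ u v → trans (arcs R u v) (arcsAreWires u v))
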